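{- Let $G=([n],E)$ be a graph (with any fixed total ordering of edges). If $i\ge n+j$, or if $j\ge i\ge n\ge 2$, then $\mathrm{FT}^{(i)}(G+P_j)$ is empty, so $(F_G)_{i,j}=0$.
   Context: For $G$ on $[n]$ and $H$ on $[n']$, $G+H$ is the graph on $[n+n'-1]$ with edge set $E(G)\cup\{\{i+n-1,j+n-1\}:\{i,j\}\in E(H)\}$. $P_j$ is the path on $[j]$ with edges $\{i,i+1\}$. Fix a total order on edges. An NBC tree is a subtree $T$ (single vertex allowed) whose edge set contains no set $C\setminus\{\max C\}$ with $C$ the edge set of a cycle. A tree triple is $(T,\alpha,r)$: $T$ an NBC tree, $\alpha$ a composition of $|V(T)|$, $1\le r\le\alpha_1$. A forest triple is a sequence of tree triples $(T_1,\alpha^{(1)},r_1),\dots,(T_m,\alpha^{(m)},r_m)$ whose vertex sets partition the vertex set, with $\min T_1<\dots<\min T_m$; sign $(-1)^{\sum(\ell(\alpha^{(i)})-1)}$, type the sorted concatenation of the $\alpha^{(i)}$, $\mathrm{type}'$ the type with one instance of $\alpha^{(1)}_1$ removed. $\mathrm{FT}^{(i)}(G+P_j)$ is the set of forest triples of $G+P_j$ such that, with $(T,\alpha,r)$ the tree triple containing $1$ and $(T',\alpha',r')$ the one containing $n$ (possibly equal), $\alpha_1=i$, $r=1$, $\{n,\dots,n+j-1\}\subseteq V(T')$ and the last part of $\alpha'$ is $\ge j$. $(F_G)_{i,j}=\sum_{\mathcal F\in\mathrm{FT}^{(i)}(G+P_j)}\mathrm{sign}(\mathcal F)e_{\mathrm{type}'(\mathcal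 F)}$, with $e_\lambda$ elementary symmetric functions. -}

module Defs where

open import Level using (0ℓ)
open import Data.Nat using (ℕ; zero; suc; _+_; _∸_; _≤_; _<_; _≥_; _⊓_; _⊔_)
open import Data.Product using (Σ; ∃; _×_; _,_; proj₁; proj₂)
open import Data.Sum using (_⊎_)
open import Data.List using (List; []; _∷_; _++_; map; length; zipWith; upTo)
open import Data.Nat.ListAction using (sum)
open import Data.List.Membership.Propositional using (_∈_; _∉_)
open import Data.List.Relation.Unary.All using (All)
open import Data.List.Relation.Unary.Any using (Any)
open import Data.List.Relation.Unary.AllPairs using (AllPairs)
open import Data.List.Relation.Unary.Linked using (Linked)
open import Data.List.Relation.Unary.Unique.Propositional using (Unique)
open import Relation.Binary using (Rel)
open import Relation.Binary.PropositionalEquality using (_≡_; _≢_)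
open import Relation.Nullary using (¬_)

-- Graphs on the vertex set [n] = {1,…,n}.
-- An edge {a,b} is stored in normalised form (a , b) with a < b.

Edge : Set
Edge = ℕ × ℕ

norm : ℕ → ℕ → Edge
norm u v = (u ⊓ v , u ⊔ v)

record Graph : Set where
  constructor graph
  field
    n : ℕ
    E : List Edge
open Graph public

WF : Graph → Set
WF G = All (λ e → 1 ≤ proj₁ e × proj₁ e < proj₂ e × proj₂ e ≤ n G) (E G)

shiftE : ℕ → Edge → Edge
shiftE k (a , b) = (a + k , b + k)

_⊕_ : Graph → Graph → Graph
G ⊕ H = graph (n G + n H ∸ 1) (E G ++ map (shiftE (n G ∸ 1)) (E H))

P : ℕ → Graph
P j = graph j (map (λ i → (suc i , suc (suc i))) (upTo (j ∸ 1)))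

Adj : List Edge → ℕ → ℕ → Set
Adj S u v = norm u v ∈ S × u ≢ v

data Walk (S : List Edge) : ℕ → ℕ → Set where
  here : ∀ {u} → Walk S u u
  step : ∀ {u w v} → Adj S u w → Walk S w v → Walk S u v

-- Cycles of G: a cyclic sequence of k ≥ 3 distinct vertices with
-- consecutive vertices (cyclically) adjacent.  Its edge set:

cycleEdges : ℕ → List ℕ → List Edge
cycleEdges v vs = zipWith norm (v ∷ vs) (vs ++ (v ∷ []))

record Cycle (G : Graph) : Set where
  field
    v₀       : ℕ
    vs       : List ℕ
    long     : 2 ≤ length vs
    distinct : Unique (v₀ ∷ vs)
    edgesIn  : All (λ e → e ∈ E G) (cycleEdges v₀ vs)
open Cycle public

edgesOf : ∀ {G} → Cycle G → List Edge
edgesOf C = cycleEdges (v₀ C) (vs C)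

IsMax : Rel Edge 0ℓ → Edge → List Edge → Set
IsMax R m C = m ∈ C × All (λ e → e ≡ m ⊎ R e m) C

-- S contains the broken circuit C ∖ {max C}
ContainsBroken : Rel Edge 0ℓ → List Edge → List Edge → Set
ContainsBroken R C S = Σ Edge λ m → IsMax R m C × All (λ e → e ≡ m ⊎ e ∈ S) C

record IsTree (G : Graph) (V : List ℕ) (S : List Edge) : Set where
  field
    V-unique  : Unique V
    V-in      : All (λ v → 1 ≤ v × v ≤ n G) V
    S-unique  : Unique S
    S-in      : All (λ e → e ∈ E G × proj₁ e ∈ V × proj₂ e ∈ V) S
    connected : ∀ {u v} → u ∈ V → v ∈ V → Walk S u v
    size      : length S + 1 ≡ length V

IsNBCTree : Rel Edge 0ℓ → (G : Graph) → List ℕ → List Edge → Set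
IsNBCTree R G V S = IsTree G V S × (∀ (C : Cycle G) → ¬ ContainsBroken R (edgesOf C) S)

-- Tree triples (T , α , r), the composition α written first ∷ rest

lastPart : ℕ → List ℕ → ℕ
lastPart a []       = a
lastPart a (b ∷ bs) = lastPart b bs

record TreeTriple (R : Rel Edge 0ℓ) (G : Graph) : Set where
  field
    V      : List ℕ
    S      : List Edge
    nbc    : IsNBCTree R G V S
    first  : ℕ
    rest   : List ℕ
    parts+ : All (1 ≤_) (first ∷ rest)
    compo  : sum (first ∷ rest) ≡ length V
    r      : ℕ
    r-lo   : 1 ≤ r
    r-hi   : r ≤ first
open TreeTriple public

IsMinOf : ℕ → List ℕ → Set
IsMinOf m V = m ∈ V × All (m ≤_) V

record ForestTriple (R : Rel Edge 0ℓ) (G : Graph) : Set where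
  field
    trees    : List (TreeTriple R G)
    disjoint : AllPairs (λ t u → ∀ {v} → v ∈ V t → v ∉ V u) trees
    covering : ∀ v → 1 ≤ v → v ≤ n G → Any (λ t → v ∈ V t) trees
    ordered  : Linked (λ t u → ∀ m m' → IsMinOf m (V t) → IsMinOf m' (V u) → m < m') trees
open ForestTriple public

InFT : (R : Rel Edge 0ℓ) (G : Graph) (i j : ℕ) → ForestTriple R (G ⊕ P j) → Set
InFT R G i j F =
  Any (λ t → 1 ∈ V t × first t ≡ i × r t ≡ 1) (trees F) ×
  Any (λ t → n G ∈ V t
           × (∀ k → n G ≤ k → k ≤ n G + j ∸ 1 → k ∈ V t)
           × j ≤ lastPart (first t) (rest t)) (trees F)

FT : (R : Rel Edge 0ℓ) (G : Graph) (i j : ℕ) → Set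
FT R G i j = Σ (ForestTriple R (G ⊕ P j)) (InFT R G i j)

{-# OPTIONS --safe #-}
module Submission where

-- Both alternatives fail by counting vertices alone.  The tree T containing 1 has |T| ≥ α₁ = i vertices, while
-- G + P_j has only n + j − 1, which settles i ≥ n + j.  If j ≥ i ≥ n ≥ 2 and T were not
-- the tree T′ containing n, …, n + j − 1, then T would lie inside {1, …, n − 1}, too
-- small for i ≥ n vertices.  So T = T′ contains 1 and those j vertices: a single part
-- α = (i) gives i = |T| ≥ j + 1 > i, and two or more parts give |T| ≥ i + j ≥ n + j.

open import Defs
open import Level using (0ℓ)
open import Data.Nat using (ℕ; suc; z≤n; s≤s; pred; _∸_; _+_; _≤_; _≥_; _≰_; NonZero; >-nonZero; _<?_)
open import Data.Nat.Properties
open import Data.Nat.ListAction using (sum)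
open import Data.Product as Product using (_×_; _,_; proj₁; ∃; ∃₂)
open import Data.Sum using (_⊎_; inj₁; inj₂; [_,_])
open import Data.Empty using (⊥)
open import Data.List using (List; []; _∷_; length; applyUpTo)
open import Data.List.Properties using (length-applyUpTo; length-removeAt′)
open import Data.List.Membership.Propositional using (_∈_; _∉_; _─_)
open import Data.List.Membership.Propositional.Properties using (∈-applyUpTo⁺; ∈-applyUpTo⁻)
open import Data.List.Relation.Binary.Subset.Propositional using (_⊆_)
open import Data.List.Relation.Unary.All as All using (All)
open import Data.List.Relation.Unary.Any as Any using (Any; here; there)
open import Data.List.Relation.Unary.AllPairs using (AllPairs; []; _∷_)
open import Data.List.Relation.Unary.Unique.Propositional using (Unique)
open import Data.List.Relation.Unary.Unique.Propositional.Properties using (applyUpTo⁺₁)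
open import Relation.Binary using (Rel; IsStrictTotalOrder)
open import Relation.Binary.PropositionalEquality using (_≡_; _≢_; refl; sym; cong; subst)
open import Relation.Nullary using (¬_; yes; no; contradiction)

private
  variable
    A : Set

∈-─⁺ : ∀ {x y : A} {ys} (x∈ys : x ∈ ys) → y ∈ ys → x ≢ y → y ∈ ys ─ x∈ys
∈-─⁺ (here refl)  (here refl)  x≢y = contradiction refl x≢y
∈-─⁺ (here _)     (there y∈ys) _   = y∈ys
∈-─⁺ (there _)    (here refl)  _   = here refl
∈-─⁺ (there x∈ys) (there y∈ys) x≢y = there (∈-─⁺ x∈ys y∈ys x≢y)

Unique-⊆⇒length≤ : ∀ {xs ys : List A} → Unique xs → xs ⊆ ys → length xs ≤ length ys
Unique-⊆⇒length≤ []         _     = z≤n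
Unique-⊆⇒length≤ {xs = x ∷ xs} {ys} (x∉xs ∷ u) xs⊆ys = begin
  suc (length xs)          ≤⟨ s≤s (Unique-⊆⇒length≤ u xs⊆ys─x) ⟩
  suc (length (ys ─ x∈ys)) ≡⟨ length-removeAt′ ys (Any.index x∈ys) ⟨
  length ys                ∎
  where
  open ≤-Reasoning
  x∈ys = xs⊆ys (here refl)
  xs⊆ys─x : xs ⊆ ys ─ x∈ys
  xs⊆ys─x y∈xs = ∈-─⁺ x∈ys (xs⊆ys (there y∈xs)) (All.lookup x∉xs y∈xs)

interval : ℕ → ℕ → List ℕ
interval a k = applyUpTo (a +_) k

Unique-bounded⇒length≤ : ∀ {m} {xs : List ℕ} → Unique xs → All (λ v → 1 ≤ v × v ≤ m) xs → length xs ≤ m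
Unique-bounded⇒length≤ {m} {xs} u bounded =
  subst (length xs ≤_) (length-applyUpTo (1 +_) m) (Unique-⊆⇒length≤ u (λ v∈xs → 1≤v≤m⇒∈ (All.lookup bounded v∈xs)))
  where
  1≤v≤m⇒∈ : ∀ {v} → 1 ≤ v × v ≤ m → v ∈ interval 1 m
  1≤v≤m⇒∈ {suc _} (_ , v≤m) = ∈-applyUpTo⁺ (1 +_) v≤m

Unique-interval : ∀ a k → Unique (interval a k)
Unique-interval a k = applyUpTo⁺₁ (a +_) k (λ i<i′ _ a+i≡a+i′ → <⇒≢ i<i′ (+-cancelˡ-≡ a _ _ a+i≡a+i′))

∈-interval⇒≥ : ∀ {a k v} → v ∈ interval a k → a ≤ v
∈-interval⇒≥ {a} v∈ with i , _ , refl ← ∈-applyUpTo⁻ (a +_) v∈ = m≤m+n a i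

n≰pred[n] : ∀ {n} → .{{NonZero n}} → n ≰ pred n
n≰pred[n] {n} n≤pred[n] = n≮n n (m≤pred[n]⇒suc[m]≤n n≤pred[n])

lastPart≤sum : ∀ a bs → lastPart a bs ≤ sum (a ∷ bs)
lastPart≤sum a []       = m≤m+n a 0
lastPart≤sum a (b ∷ bs) = ≤-trans (lastPart≤sum b bs) (m≤n+m _ a)

sum≡head⊎head+last≤sum : ∀ a bs → sum (a ∷ bs) ≡ a ⊎ a + lastPart a bs ≤ sum (a ∷ bs)
sum≡head⊎head+last≤sum a []       = inj₁ (+-identityʳ a)
sum≡head⊎head+last≤sum a (b ∷ bs) = inj₂ (+-monoʳ-≤ a (lastPart≤sum b bs))

AllPairs-Any² : ∀ {_~_ : Rel A 0ℓ} {P Q : A → Set} {xs} → AllPairs _~_ xs → Any P xs → Any Q xs →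
                (∃ λ x → P x × Q x) ⊎ (∃₂ λ x y → P x × Q y × (x ~ y ⊎ y ~ x))
AllPairs-Any² (_ ∷ _)   (here px)  (here qx)  = inj₁ (_ , px , qx)
AllPairs-Any² (x~ ∷ _)  (here px)  (there qs) with x~y , qy ← All.lookupAny x~ qs =
  inj₂ (_ , _ , px , qy , inj₁ x~y)
AllPairs-Any² (x~ ∷ _)  (there ps) (here qx)  with x~y , py ← All.lookupAny x~ ps =
  inj₂ (_ , _ , py , qx , inj₂ x~y)
AllPairs-Any² (_ ∷ ~xs) (there ps) (there qs) = AllPairs-Any² ~xs ps qs

module _ {R : Rel Edge 0ℓ} {H : Graph} (t : TreeTriple R H) where
  open IsTree (proj₁ (nbc t))

  first≤size : first t ≤ length (V t)
  first≤size = subst (first t ≤_) (compo t) (m≤m+n (first t) (sum (rest t)))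

  size≤ : ∀ {m} → (∀ {v} → v ∈ V t → v ≤ n H → v ≤ m) → length (V t) ≤ m
  size≤ below = Unique-bounded⇒length≤ V-unique (All.tabulate λ v∈ → Product.map₂ (below v∈) (All.lookup V-in v∈))

  size≤n : length (V t) ≤ n H
  size≤n = size≤ λ _ v≤n → v≤n

module _ {R : Rel Edge 0ℓ} {G : Graph} {j : ℕ} where

  ContainsPath : TreeTriple R (G ⊕ P j) → Set
  ContainsPath t = ∀ k → n G ≤ k → k ≤ n G + j ∸ 1 → k ∈ V t

  interval⊆ : ∀ t → ContainsPath t → interval (n G) j ⊆ V t
  interval⊆ _ path⊆t v∈ with i , i<j , refl ← ∈-applyUpTo⁻ (n G +_) v∈ =
    path⊆t (n G + i) (m≤m+n (n G) i) (<⇒≤pred (+-monoʳ-< (n G) i<j))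

  1+j≤size : ∀ t → 2 ≤ n G → 1 ∈ V t → ContainsPath t → suc j ≤ length (V t)
  1+j≤size t n≥2 1∈t path⊆t =
    subst (_≤ length (V t)) (cong suc (length-applyUpTo (n G +_) j))
      (Unique-⊆⇒length≤ (1∉interval ∷ Unique-interval (n G) j) 1∷interval⊆t)
    where
    1∉interval : All (1 ≢_) (interval (n G) j)
    1∉interval = All.tabulate λ v∈ 1≡v → <⇒≱ n≥2 (subst (n G ≤_) (sym 1≡v) (∈-interval⇒≥ v∈))
    1∷interval⊆t : 1 ∷ interval (n G) j ⊆ V t
    1∷interval⊆t (here refl) = 1∈t
    1∷interval⊆t (there v∈) = interval⊆ t path⊆t v∈

  size≤pred[n] : (t u : TreeTriple R (G ⊕ P j)) → ContainsPath u → (∀ {v} → v ∈ V u → v ∉ V t) →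
                 length (V t) ≤ pred (n G)
  size≤pred[n] t u path⊆u u∩t≡∅ = size≤ t below
    where
    below : ∀ {v} → v ∈ V t → v ≤ n G + j ∸ 1 → v ≤ pred (n G)
    below {v} v∈t v≤N with v <? n G
    ... | yes v<n = <⇒≤pred v<n
    ... | no  v≮n = contradiction v∈t (u∩t≡∅ (path⊆u v (≮⇒≥ v≮n) v≤N))

  no-tree-contains-1-and-path : ∀ {i} (t : TreeTriple R (G ⊕ P j)) → n G ≤ i → i ≤ j → 2 ≤ n G →
                                1 ∈ V t → first t ≡ i → ContainsPath t → j ≤ lastPart (first t) (rest t) → ⊥
  no-tree-contains-1-and-path {i} t n≤i i≤j n≥2 1∈t refl path⊆t j≤last
    with sum≡head⊎head+last≤sum (first t) (rest t)
  ... | inj₁ sum≡i = <⇒≱ (1+j≤size t n≥2 1∈t path⊆t) (begin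
    length (V t)           ≡⟨ compo t ⟨
    sum (first t ∷ rest t) ≡⟨ sum≡i ⟩
    i                      ≤⟨ i≤j ⟩
    j                      ∎)
    where open ≤-Reasoning
  ... | inj₂ i+last≤sum = n≰pred[n] {{>-nonZero (≤-trans (<⇒≤ n≥2) (m≤m+n (n G) j))}} (begin
    n G + j                 ≤⟨ +-mono-≤ n≤i j≤last ⟩
    i + lastPart i (rest t) ≤⟨ i+last≤sum ⟩
    sum (i ∷ rest t)        ≡⟨ compo t ⟩
    length (V t)            ≤⟨ size≤n t ⟩
    pred (n G + j)          ∎)
    where open ≤-Reasoning

proposition3p6 : (G : Graph) → WF G → 1 ≤ n G →
                 (R : Rel Edge 0ℓ) → IsStrictTotalOrder _≡_ R →
                 (i j : ℕ) → 1 ≤ j →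
                 (n G + j ≤ i ⊎ (j ≥ i × i ≥ n G × n G ≥ 2)) →
                 ¬ FT R G i j
proposition3p6 G _ _ R _ i j j≥1 (inj₁ n+j≤i) (_ , has1 , _)
  with t , _ , refl , _ ← Any.satisfied has1 =
  n≰pred[n] {{>-nonZero (m≤n⇒m≤o+n (n G) j≥1)}} (≤-trans n+j≤i (≤-trans (first≤size t) (size≤n t)))
proposition3p6 G _ _ R _ i j _ (inj₂ (i≤j , n≤i , n≥2)) (F , has1 , hasPath)
  with AllPairs-Any² (disjoint F) has1 hasPath
... | inj₁ (t , (1∈t , first≡i , _) , (_ , path⊆t , j≤last)) =
  no-tree-contains-1-and-path t n≤i i≤j n≥2 1∈t first≡i path⊆t j≤last
... | inj₂ (t , u , (_ , refl , _) , (_ , path⊆u , _) , t#u) =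
  n≰pred[n] {{>-nonZero (<⇒≤ n≥2)}} (≤-trans n≤i (≤-trans (first≤size t) (size≤pred[n] t u path⊆u u∩t≡∅)))
  where
  u∩t≡∅ : ∀ {v} → v ∈ V u → v ∉ V t
  u∩t≡∅ v∈u v∈t = [ (λ t#u → t#u v∈t v∈u) , (λ u#t → u#t v∈u v∈t) ] t#u
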